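{- Let $\mathcal S\in\Sigma^n$ be a string over an integer alphabet $\Sigma$ and let $\pi:[n]\to[n]$ be an order-preserving permutation for $\mathcal S$. Then $\mathcal S$ can be compressed in $O(|\mathrm{PDA}_\pi|\log n)$ bits of space (i.e., there is an encoding of $\mathcal S$ of this size from which every character of $\mathcal S$ can be recovered).
   Context: Strings are 1-indexed, $\mathcal S[i,j]=\mathcal S[i]\cdots\mathcal S[j]$; the alphabet $\Sigma=\{0,\dots,\sigma-1\}$ with $\sigma\le n$. For $i\neq j$, $\mathrm{rlce}(i,j)$ is the length of the longest common prefix of $\mathcal S[i,n]$ and $\mathcal S[j,n]$. A permutation $\pi$ of $[n]$ is order-preserving for $\mathcal S$ if for all $i,j\in[n-1]$, $\pi(i)<\pi(j)$ and $\mathcal S[i,i+1]=\mathcal S[j,j+1]$ imply $\pi(i+1)<\pi(j+1)$. $\mathrm{LPF}_\pi[i]=0$ if $\pi(i)=1$, else $\mathrm{LPF}_\pi[i]=\max_{j:\pi(j)<\pi(i)}\mathrm{rlce}(j,i)$. $\mathrm{PDA}_\pi$ is the set of distinct values $\{i+\mathrm{LPF}_\pi[i]: i\in[n]\}$ (sorted colexicographically by the prefixes $\mathcal S[1,j]$); $|\mathrm{PDA}_\pi|$ denotes its cardinality. -}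

module Defs where

open import Data.Nat using (ℕ; zero; suc; _+_; _<_; _⊔_)
open import Data.Nat.Properties using (_≟_; _<?_)
open import Data.Fin using (Fin; toℕ)
open import Data.Fin.Permutation using (Permutation′; _⟨$⟩ʳ_)
open import Data.Vec using (Vec; lookup)
open import Data.List using (List; length; map; filter; deduplicate; foldr; allFin)
open import Data.Maybe using (Maybe; just; nothing)
open import Relation.Binary.PropositionalEquality using (_≡_)
open import Relation.Nullary using (yes; no)
import Data.Fin.Properties as FinP

-- Convention: positions are 0-indexed (Fin n); position k here is
-- position k+1 in the paper. A string S ∈ Σ^n with Σ = {0,…,σ-1}
-- is a Vec (Fin σ) n.

module _ {σ n : ℕ} (S : Vec (Fin σ) n) where

  charAt : ℕ → Maybe (Fin σ)
  charAt k with k <? n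
  ... | yes k<n = just (lookup S (Data.Fin.fromℕ< k<n))
  ... | no _    = nothing

  -- length of the longest common prefix of S[i..] and S[j..],
  -- computed with fuel (n units of fuel always suffice)
  lcpFuel : ℕ → ℕ → ℕ → ℕ
  lcpFuel zero    i j = 0
  lcpFuel (suc f) i j with charAt i | charAt j
  ... | just a | just b with a FinP.≟ b
  ...   | yes _ = suc (lcpFuel f (suc i) (suc j))
  ...   | no  _ = 0
  lcpFuel (suc f) i j | _ | _ = 0

  rlce : Fin n → Fin n → ℕ
  rlce i j = lcpFuel n (toℕ i) (toℕ j)

  OrderPreserving : Permutation′ n → Set
  OrderPreserving π =
    ∀ (i i' j j' : Fin n) →
    toℕ i' ≡ suc (toℕ i) → toℕ j' ≡ suc (toℕ j) →
    toℕ (π ⟨$⟩ʳ i) < toℕ (π ⟨$⟩ʳ j) →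
    lookup S i ≡ lookup S j → lookup S i' ≡ lookup S j' →
    toℕ (π ⟨$⟩ʳ i') < toℕ (π ⟨$⟩ʳ j')

  maxList : List ℕ → ℕ
  maxList = foldr _⊔_ 0

  -- LPF_π[i] = 0 if π(i) is the first rank, else max over j with
  -- π(j) < π(i) of rlce(j,i)  (the max over the empty set is the rank-1 case)
  LPF : Permutation′ n → Fin n → ℕ
  LPF π i =
    maxList (map (λ j → rlce j i)
                 (filter (λ j → toℕ (π ⟨$⟩ʳ j) <? toℕ (π ⟨$⟩ʳ i)) (allFin n)))

  pdaSize : Permutation′ n → ℕ
  pdaSize π = length (deduplicate _≟_ (map (λ i → toℕ i + LPF π i) (allFin n)))

{-# OPTIONS --safe #-}
module Submission where

-- A string S is determined by the parse that, for every distinct value v = i + LPF_π[i]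
-- of PDA_π, records the least such position i, a source j with π(j) < π(i) attaining
-- LPF_π[i], and the explicit character S[v]. Every position p lies in the phrase of
-- v = p + LPF_π[p]: either p = v and its character is stored, or p lies in the copied
-- range, and its character equals that of a position of smaller π-rank, because order
-- preservation propagates π(j) < π(i) along the common extension of j and i. Following
-- copies therefore terminates after fewer than n steps, and the parse is |PDA_π|
-- quadruples of numbers ≤ n, each written in O(log n) self-delimiting bits.

open import Defs
open import Data.Bool using (Bool; true; false)
open import Data.Empty using (⊥)
open import Data.Fin as Fin using (Fin; toℕ; fromℕ<)
open import Data.Fin.Permutation using (Permutation′; _⟨$⟩ʳ_)
open import Data.Fin.Properties using (toℕ<n; toℕ-injective; toℕ-fromℕ<; fromℕ<-toℕ)
open import Data.List
  using (List; []; _∷_; _++_; length; map; concatMap; mapMaybe; filter; deduplicate; allFin; tabulate)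
open import Data.List.Properties using (++-assoc; ++-identityʳ; length-++; length-map; tabulate-cong)
open import Data.List.Membership.Propositional using (_∈_; lose)
open import Data.List.Membership.Propositional.Properties
  using (foldr-selective; ∈-map⁺; ∈-map⁻; ∈-filter⁻; ∈-allFin; ∈-deduplicate⁺)
open import Data.List.Relation.Unary.All as All using (All; []; _∷_)
open import Data.List.Relation.Unary.All.Properties using (map⁺; concat⁺)
open import Data.List.Relation.Unary.Any as Any using (Any)
import Data.List.Relation.Unary.Any.Properties as Any
open import Data.Maybe as Maybe using (Maybe; just; nothing; maybe′)
import Data.Maybe.Relation.Unary.Any as MaybeAny
open import Data.Nat
open import Data.Nat.Properties
open import Data.Nat.Logarithm using (⌊log₂_⌋; ⌊log₂⌋-mono-≤; ⌊log₂[2*b]⌋≡1+⌊log₂b⌋)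
open import Data.Nat.Tactic.RingSolver using (solve-∀)
open import Data.Product using (Σ; Σ-syntax; _×_; _,_; proj₂)
open import Data.Sum using (_⊎_; inj₁; inj₂)
open import Data.Vec using (Vec; []; _∷_; lookup; toList)
open import Function using (_∘_)
open import Relation.Binary.PropositionalEquality
open import Relation.Nullary using (Dec; yes; no; contradiction)
open import Relation.Nullary.Decidable using (_×-dec_; _⊎-dec_)
open import Relation.Unary using (Pred; Decidable)

first : ∀ {m p} {P : Pred (Fin m) p} → Decidable P → Maybe (Fin m)
first {zero}  P? = nothing
first {suc m} P? with P? Fin.zero
... | yes _ = just Fin.zero
... | no  _ = Maybe.map Fin.suc (first (λ i → P? (Fin.suc i)))

first-least : ∀ {m p} {P : Pred (Fin m) p} (P? : Decidable P) {j} → P j →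
              MaybeAny.Any (λ i → P i × toℕ i ≤ toℕ j) (first P?)
first-least {suc m} P? Pj with P? Fin.zero
... | yes P0 = MaybeAny.just (P0 , z≤n)
first-least {suc m} P? {Fin.zero}  Pj | no ¬P0 = contradiction Pj ¬P0
first-least {suc m} {P = P} P? {Fin.suc j} Pj | no _ =
  liftSuc (first-least (λ i → P? (Fin.suc i)) Pj)
  where
  liftSuc : ∀ {mi} → MaybeAny.Any (λ i → P (Fin.suc i) × toℕ i ≤ toℕ j) mi →
            MaybeAny.Any (λ i → P i × toℕ i ≤ suc (toℕ j)) (Maybe.map Fin.suc mi)
  liftSuc (MaybeAny.just (Pi , i≤j)) = MaybeAny.just (Pi , s≤s i≤j)

length-mapMaybe : ∀ {A B : Set} (f : A → Maybe B) xs → length (mapMaybe f xs) ≤ length xs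
length-mapMaybe f []       = z≤n
length-mapMaybe f (x ∷ xs) with f x
... | just _  = s≤s (length-mapMaybe f xs)
... | nothing = m≤n⇒m≤1+n (length-mapMaybe f xs)

tabulate-lookup-toList : ∀ {A B : Set} {n} (f : A → B) (xs : Vec A n) →
                         tabulate (λ p → f (lookup xs p)) ≡ map f (toList xs)
tabulate-lookup-toList f []       = refl
tabulate-lookup-toList f (x ∷ xs) = cong (f x ∷_) (tabulate-lookup-toList f xs)

bitValue : Bool → ℕ
bitValue false = 0
bitValue true  = 1

lowBit : ℕ → Bool
lowBit 0             = false
lowBit 1             = true
lowBit (suc (suc n)) = lowBit n

lowBit+2*⌊n/2⌋≡n : ∀ n → bitValue (lowBit n) + 2 * ⌊ n /2⌋ ≡ n
lowBit+2*⌊n/2⌋≡n 0             = refl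
lowBit+2*⌊n/2⌋≡n 1             = refl
lowBit+2*⌊n/2⌋≡n (suc (suc n)) = begin
  bitValue (lowBit n) + 2 * suc ⌊ n /2⌋   ≡⟨ shift (bitValue (lowBit n)) ⌊ n /2⌋ ⟩
  2 + (bitValue (lowBit n) + 2 * ⌊ n /2⌋) ≡⟨ cong (2 +_) (lowBit+2*⌊n/2⌋≡n n) ⟩
  2 + n                                   ∎
  where
  open ≡-Reasoning
  shift : ∀ b h → b + 2 * suc h ≡ 2 + (b + 2 * h)
  shift = solve-∀

2*⌊n/2⌋≤n : ∀ n → 2 * ⌊ n /2⌋ ≤ n
2*⌊n/2⌋≤n n = subst (2 * ⌊ n /2⌋ ≤_) (lowBit+2*⌊n/2⌋≡n n) (m≤n+m (2 * ⌊ n /2⌋) (bitValue (lowBit n)))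

fromBits : List Bool → ℕ
fromBits []       = 0
fromBits (b ∷ bs) = bitValue b + 2 * fromBits bs

-- Least significant bit first; the fuel f must be at least the number.
toBits : ℕ → ℕ → List Bool
toBits _       zero      = []
toBits zero    (suc _)   = []
toBits (suc f) n@(suc _) = lowBit n ∷ toBits f ⌊ n /2⌋

fromBits-toBits : ∀ {f n} → n ≤ f → fromBits (toBits f n) ≡ n
fromBits-toBits {n = zero}  _ = refl
fromBits-toBits {suc f} {n@(suc m)} n≤1+f = begin
  bitValue (lowBit n) + 2 * fromBits (toBits f ⌊ n /2⌋)
    ≡⟨ cong (λ h → bitValue (lowBit n) + 2 * h)
            (fromBits-toBits (≤-trans (s≤s⁻¹ (⌊n/2⌋<n m)) (s≤s⁻¹ n≤1+f))) ⟩
  bitValue (lowBit n) + 2 * ⌊ n /2⌋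
    ≡⟨ lowBit+2*⌊n/2⌋≡n n ⟩
  n ∎
  where open ≡-Reasoning

length-toBits : ∀ f n → length (toBits f n) ≤ 1 + ⌊log₂ n ⌋
length-toBits _       zero          = z≤n
length-toBits zero    (suc _)       = z≤n
length-toBits (suc f) 1             = s≤s z≤n
length-toBits (suc f) n@(suc (suc _)) = s≤s (begin
  length (toBits f h)  ≤⟨ length-toBits f h ⟩
  1 + ⌊log₂ h ⌋        ≡⟨ ⌊log₂[2*b]⌋≡1+⌊log₂b⌋ h ⟨
  ⌊log₂ (2 * h) ⌋      ≤⟨ ⌊log₂⌋-mono-≤ (2*⌊n/2⌋≤n n) ⟩
  ⌊log₂ n ⌋            ∎)
  where
  open ≤-Reasoning
  h = ⌊ n /2⌋

delimit : List Bool → List Bool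
delimit []       = false ∷ []
delimit (b ∷ bs) = true ∷ b ∷ delimit bs

encodeℕ : ℕ → List Bool
encodeℕ n = delimit (toBits n n)

encodeℕs : List ℕ → List Bool
encodeℕs = concatMap encodeℕ

readℕs : List Bool → List Bool → List ℕ
readℕs acc []             = []
readℕs acc (false ∷ bs)   = fromBits acc ∷ readℕs [] bs
readℕs acc (true ∷ [])    = []
readℕs acc (true ∷ b ∷ bs) = readℕs (acc ++ b ∷ []) bs

decodeℕs : List Bool → List ℕ
decodeℕs = readℕs []

readℕs-delimit : ∀ acc bs rest →
                 readℕs acc (delimit bs ++ rest) ≡ fromBits (acc ++ bs) ∷ readℕs [] rest
readℕs-delimit acc []       rest = cong (λ bs → fromBits bs ∷ readℕs [] rest) (sym (++-identityʳ acc))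
readℕs-delimit acc (b ∷ bs) rest = begin
  readℕs (acc ++ b ∷ []) (delimit bs ++ rest)      ≡⟨ readℕs-delimit (acc ++ b ∷ []) bs rest ⟩
  fromBits ((acc ++ b ∷ []) ++ bs) ∷ readℕs [] rest ≡⟨ cong (λ cs → fromBits cs ∷ readℕs [] rest)
                                                         (++-assoc acc (b ∷ []) bs) ⟩
  fromBits (acc ++ b ∷ bs) ∷ readℕs [] rest        ∎
  where open ≡-Reasoning

decodeℕs-encodeℕs : ∀ ns → decodeℕs (encodeℕs ns) ≡ ns
decodeℕs-encodeℕs []       = refl
decodeℕs-encodeℕs (n ∷ ns) = begin
  readℕs [] (delimit (toBits n n) ++ encodeℕs ns) ≡⟨ readℕs-delimit [] (toBits n n) (encodeℕs ns) ⟩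
  fromBits (toBits n n) ∷ decodeℕs (encodeℕs ns)  ≡⟨ cong₂ _∷_ (fromBits-toBits ≤-refl) (decodeℕs-encodeℕs ns) ⟩
  n ∷ ns                                          ∎
  where open ≡-Reasoning

length-delimit : ∀ bs → length (delimit bs) ≡ 1 + 2 * length bs
length-delimit []       = refl
length-delimit (b ∷ bs) = begin
  2 + length (delimit bs)  ≡⟨ cong (2 +_) (length-delimit bs) ⟩
  2 + (1 + 2 * length bs)  ≡⟨ cong suc (*-suc 2 (length bs)) ⟨
  1 + 2 * suc (length bs)  ∎
  where open ≡-Reasoning

length-encodeℕ : ∀ {m n} → n ≤ m → length (encodeℕ n) ≤ 3 * (1 + ⌊log₂ m ⌋)
length-encodeℕ {m} {n} n≤m = begin
  length (delimit (toBits n n)) ≡⟨ length-delimit (toBits n n) ⟩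
  1 + 2 * length (toBits n n)   ≤⟨ +-mono-≤ (s≤s z≤n) (*-monoʳ-≤ 2 bits≤K) ⟩
  3 * K                         ∎
  where
  open ≤-Reasoning
  K = 1 + ⌊log₂ m ⌋
  bits≤K : length (toBits n n) ≤ K
  bits≤K = ≤-trans (length-toBits n n) (s≤s (⌊log₂⌋-mono-≤ n≤m))

length-encodeℕs : ∀ {m ns} → All (_≤ m) ns → length (encodeℕs ns) ≤ length ns * (3 * (1 + ⌊log₂ m ⌋))
length-encodeℕs []                        = z≤n
length-encodeℕs {m} {n ∷ ns} (n≤m ∷ ns≤m) = begin
  length (encodeℕ n ++ encodeℕs ns)         ≡⟨ length-++ (encodeℕ n) ⟩
  length (encodeℕ n) + length (encodeℕs ns) ≤⟨ +-mono-≤ (length-encodeℕ n≤m) (length-encodeℕs ns≤m) ⟩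
  3 * K + length ns * (3 * K)               ∎
  where
  open ≤-Reasoning
  K = 1 + ⌊log₂ m ⌋

-- Positions start ≤ p < end copy position source + (p ∸ start); position end holds char.
record Phrase : Set where
  constructor phrase
  field
    start end source char : ℕ

open Phrase

phraseℕs : Phrase → List ℕ
phraseℕs (phrase i v j c) = i ∷ v ∷ j ∷ c ∷ []

phrasesFromℕs : List ℕ → List Phrase
phrasesFromℕs (i ∷ v ∷ j ∷ c ∷ ns) = phrase i v j c ∷ phrasesFromℕs ns
phrasesFromℕs _                    = []

phrasesFromℕs-concatMap : ∀ ps → phrasesFromℕs (concatMap phraseℕs ps) ≡ ps
phrasesFromℕs-concatMap []       = refl
phrasesFromℕs-concatMap (p ∷ ps) = cong (p ∷_) (phrasesFromℕs-concatMap ps)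

length-concatMap-phraseℕs : ∀ ps → length (concatMap phraseℕs ps) ≡ 4 * length ps
length-concatMap-phraseℕs []       = refl
length-concatMap-phraseℕs (p ∷ ps) = begin
  4 + length (concatMap phraseℕs ps) ≡⟨ cong (4 +_) (length-concatMap-phraseℕs ps) ⟩
  4 + 4 * length ps                  ≡⟨ *-suc 4 (length ps) ⟨
  4 * suc (length ps)                ∎
  where open ≡-Reasoning

Covers : ℕ → Phrase → Set
Covers p ph = p ≡ end ph ⊎ (start ph ≤ p × p < end ph)

covers? : ∀ p ph → Dec (Covers p ph)
covers? p ph = (p ≟ end ph) ⊎-dec ((start ph ≤? p) ×-dec (p <? end ph))

data Step : Set where
  literal copyFrom : ℕ → Step
  uncovered        : Step

step : List Phrase → ℕ → Step
step []        p = uncovered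
step (ph ∷ ps) p with covers? p ph
... | yes (inj₁ _) = literal (char ph)
... | yes (inj₂ _) = copyFrom (source ph + (p ∸ start ph))
... | no _         = step ps p

resolveStep : (ℕ → ℕ) → Step → ℕ
resolveStep _       (literal c)  = c
resolveStep resolve (copyFrom q) = resolve q
resolveStep _       uncovered    = 0

resolve : ℕ → List Phrase → ℕ → ℕ
resolve zero    ps p = 0
resolve (suc f) ps p = resolveStep (resolve f ps) (step ps p)

module CopyScheme {n : ℕ} (w : Fin n → ℕ) (rank : Fin n → ℕ) where

  Source : Fin n → ℕ → Set
  Source p q = Σ[ q′ ∈ Fin n ] toℕ q′ ≡ q × w q′ ≡ w p × rank q′ < rank p

  record Sound (ph : Phrase) : Set where
    field
      literal-sound : ∀ p → toℕ p ≡ end ph → char ph ≡ w p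
      copy-sound    : ∀ p → start ph ≤ toℕ p → toℕ p < end ph →
                      Source p (source ph + (toℕ p ∸ start ph))

  Resolves : Fin n → Step → Set
  Resolves p (literal c)  = c ≡ w p
  Resolves p (copyFrom q) = Source p q
  Resolves p uncovered    = ⊥

  step-resolves : ∀ {ps} p → All Sound ps → Any (Covers (toℕ p)) ps → Resolves p (step ps (toℕ p))
  step-resolves {ph ∷ ps} p (sound ∷ sounds) covered with covers? (toℕ p) ph
  ... | yes (inj₁ p≡end)        = Sound.literal-sound sound p p≡end
  ... | yes (inj₂ (s≤p , p<e)) = Sound.copy-sound sound p s≤p p<e
  ... | no ¬covers             = step-resolves p sounds (Any.tail ¬covers covered)

  resolve-correct : ∀ {ps} → All Sound ps → (∀ p → Any (Covers (toℕ p)) ps) →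
                    ∀ f p → rank p < f → resolve f ps (toℕ p) ≡ w p
  resolve-correct {ps} sounds covered (suc f) p rank<1+f =
    follow (step ps (toℕ p)) (step-resolves p sounds (covered p))
    where
    follow : ∀ s → Resolves p s → resolveStep (resolve f ps) s ≡ w p
    follow (literal c)  c≡w = c≡w
    follow (copyFrom _) (q , refl , same , earlier) =
      trans (resolve-correct sounds covered f q (<-≤-trans earlier (s≤s⁻¹ rank<1+f))) same

-- The first number is the length n of the string; it doubles as fuel, since ranks are below n.
expand : List ℕ → List ℕ
expand []       = []
expand (n ∷ ns) = tabulate {n = n} (λ p → resolve n (phrasesFromℕs ns) (toℕ p))

encodeParse : ℕ → List Phrase → List Bool
encodeParse n ps = encodeℕs (n ∷ concatMap phraseℕs ps)

decodeParse : List Bool → List ℕ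
decodeParse bits = expand (decodeℕs bits)

decodeParse-encodeParse : ∀ n ps →
  decodeParse (encodeParse n ps) ≡ tabulate {n = n} (λ p → resolve n ps (toℕ p))
decodeParse-encodeParse n ps
  rewrite decodeℕs-encodeℕs (n ∷ concatMap phraseℕs ps) | phrasesFromℕs-concatMap ps = refl

length-encodeParse : ∀ {n d ps} → All (All (_≤ n) ∘ phraseℕs) ps → length ps ≤ d → 1 ≤ d →
                     length (encodeParse n ps) ≤ 15 * (d * (1 + ⌊log₂ n ⌋))
length-encodeParse {n} {d} {ps} bounded ps≤d 1≤d = begin
  length (encodeParse n ps)             ≤⟨ length-encodeℕs (≤-refl ∷ concat⁺ (map⁺ bounded)) ⟩
  (1 + length (concatMap phraseℕs ps)) * (3 * K)
                                        ≡⟨ cong (λ l → (1 + l) * (3 * K)) (length-concatMap-phraseℕs ps) ⟩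
  (1 + 4 * length ps) * (3 * K)         ≤⟨ *-monoˡ-≤ (3 * K) (+-mono-≤ 1≤d (*-monoʳ-≤ 4 ps≤d)) ⟩
  (d + 4 * d) * (3 * K)                 ≡⟨ regroup d K ⟩
  15 * (d * K)                          ∎
  where
  open ≤-Reasoning
  K = 1 + ⌊log₂ n ⌋
  regroup : ∀ d K → (d + 4 * d) * (3 * K) ≡ 15 * (d * K)
  regroup = solve-∀

module _ {σ n : ℕ} (S : Vec (Fin σ) n) where

  charAt-toℕ : ∀ p → charAt S (toℕ p) ≡ just (lookup S p)
  charAt-toℕ p with toℕ p <? n
  ... | yes p<n = cong (just ∘ lookup S) (fromℕ<-toℕ p p<n)
  ... | no  p≮n = contradiction (toℕ<n p) p≮n

  charAt≡just : ∀ a {c} → charAt S a ≡ just c → Σ[ x ∈ Fin n ] toℕ x ≡ a × lookup S x ≡ c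
  charAt≡just a eq with a <? n
  charAt≡just a refl | yes a<n = fromℕ< a<n , toℕ-fromℕ< a<n , refl

  lcpFuel-match : ∀ f a b k → k < lcpFuel S f a b →
                  Σ[ x ∈ Fin n ] Σ[ y ∈ Fin n ]
                    toℕ x ≡ a + k × toℕ y ≡ b + k × lookup S x ≡ lookup S y
  lcpFuel-match (suc f) a b k k<lcp with charAt S a in a↦c | charAt S b in b↦d
  ... | just c | just d with c Fin.≟ d
  lcpFuel-match (suc f) a b zero _ | just c | just d | yes c≡d
    with charAt≡just a a↦c | charAt≡just b b↦d
  ... | x , x≡a , Sx≡c | y , y≡b , Sy≡d =
    x , y , trans x≡a (sym (+-identityʳ a)) , trans y≡b (sym (+-identityʳ b)) ,
    trans Sx≡c (trans c≡d (sym Sy≡d))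
  lcpFuel-match (suc f) a b (suc k) (s≤s k<lcp) | just c | just d | yes _
    with lcpFuel-match f (suc a) (suc b) k k<lcp
  ... | x , y , x≡ , y≡ , same = x , y , trans x≡ (sym (+-suc a k)) , trans y≡ (sym (+-suc b k)) , same

  module _ (π : Permutation′ n) where

    rank : Fin n → ℕ
    rank i = toℕ (π ⟨$⟩ʳ i)

    common-extension : OrderPreserving S π → ∀ {i j} → rank j < rank i → ∀ k → k < rlce S j i →
                       Σ[ x ∈ Fin n ] Σ[ y ∈ Fin n ]
                         toℕ x ≡ toℕ j + k × toℕ y ≡ toℕ i + k ×
                         lookup S x ≡ lookup S y × rank x < rank y
    common-extension _ {i} {j} j<i zero k<lcp with lcpFuel-match n (toℕ j) (toℕ i) 0 k<lcp
    ... | x , y , x≡ , y≡ , same =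
      x , y , x≡ , y≡ , same ,
      subst₂ (λ u v → rank u < rank v)
             (sym (toℕ-injective (trans x≡ (+-identityʳ (toℕ j)))))
             (sym (toℕ-injective (trans y≡ (+-identityʳ (toℕ i))))) j<i
    common-extension op {i} {j} j<i (suc k) k<lcp
      with common-extension op j<i k (<-trans (n<1+n k) k<lcp)
         | lcpFuel-match n (toℕ j) (toℕ i) (suc k) k<lcp
    ... | x′ , y′ , x′≡ , y′≡ , same′ , x′<y′ | x , y , x≡ , y≡ , same =
      x , y , x≡ , y≡ , same , op x′ x y′ y (next x′≡ x≡) (next y′≡ y≡) x′<y′ same′ same
      where
      next : ∀ {a} {u v : Fin n} → toℕ u ≡ a + k → toℕ v ≡ a + suc k → toℕ v ≡ suc (toℕ u)
      next {a} u≡ v≡ = trans v≡ (trans (+-suc a k) (cong suc (sym u≡)))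

    LPFWitness : Fin n → Set
    LPFWitness i = Σ[ j ∈ Fin n ] rank j < rank i × rlce S j i ≡ LPF S π i

    LPF-attained : ∀ i → LPF S π i ≡ 0 ⊎ LPFWitness i
    LPF-attained i
      with foldr-selective ⊔-sel 0 (map (λ j → rlce S j i) (filter (λ j → rank j <? rank i) (allFin n)))
    ... | inj₁ LPF≡0 = inj₁ LPF≡0
    ... | inj₂ LPF∈ with ∈-map⁻ (λ j → rlce S j i) LPF∈
    ...   | j , j∈ , LPF≡ =
      inj₂ (j , proj₂ (∈-filter⁻ (λ j → rank j <? rank i) {xs = allFin n} j∈) , sym LPF≡)

    sourceOf : ∀ {i} → LPF S π i ≡ 0 ⊎ LPFWitness i → ℕ
    sourceOf (inj₁ _)       = 0
    sourceOf (inj₂ (j , _)) = toℕ j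

    pdaEnd : Fin n → ℕ
    pdaEnd i = toℕ i + LPF S π i

    -- pdaEnd i ≤ n holds anyway; clamping spares proving it and keeps every stored number ≤ n.
    phraseEnd : Fin n → ℕ
    phraseEnd i = pdaEnd i ⊓ n

    pdaPhrase : Fin n → Phrase
    pdaPhrase i =
      phrase (toℕ i) (phraseEnd i) (sourceOf (LPF-attained i)) (maybe′ toℕ 0 (charAt S (phraseEnd i)))

    open CopyScheme (λ p → toℕ (lookup S p)) rank

    offset<LPF : ∀ {i p : Fin n} → toℕ i ≤ toℕ p → toℕ p < pdaEnd i → toℕ p ∸ toℕ i < LPF S π i
    offset<LPF {i} {p} i≤p p<end =
      +-cancelˡ-< (toℕ i) _ _ (subst (_< pdaEnd i) (sym (m+[n∸m]≡n i≤p)) p<end)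

    copied-from-source : OrderPreserving S π → ∀ {i} (a : LPF S π i ≡ 0 ⊎ LPFWitness i) p →
                         toℕ i ≤ toℕ p → toℕ p < pdaEnd i → Source p (sourceOf a + (toℕ p ∸ toℕ i))
    copied-from-source _ (inj₁ LPF≡0) p i≤p p<end =
      contradiction (subst (_ <_) LPF≡0 (offset<LPF i≤p p<end)) n≮0
    copied-from-source op (inj₂ (j , j<i , lcp≡LPF)) p i≤p p<end
      with common-extension op j<i _ (subst (_ <_) (sym lcp≡LPF) (offset<LPF i≤p p<end))
    ... | x , y , x≡ , y≡ , same , x<y with toℕ-injective (trans y≡ (m+[n∸m]≡n i≤p))
    ...   | refl = x , x≡ , cong toℕ same , x<y

    pdaPhrase-sound : OrderPreserving S π → ∀ i → Sound (pdaPhrase i)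
    pdaPhrase-sound op i = record
      { literal-sound = λ p p≡end →
          cong (maybe′ toℕ 0) (trans (cong (charAt S) (sym p≡end)) (charAt-toℕ p))
      ; copy-sound    = λ p i≤p p<end →
          copied-from-source op (LPF-attained i) p i≤p (<-≤-trans p<end (m⊓n≤m (pdaEnd i) n))
      }

    pdaPhrase-covers : ∀ {i p : Fin n} → toℕ i ≤ toℕ p → pdaEnd i ≡ pdaEnd p → Covers (toℕ p) (pdaPhrase i)
    pdaPhrase-covers {i} {p} i≤p same-end
      with m≤n⇒m<n∨m≡n (⊓-glb (subst (toℕ p ≤_) (sym same-end) (m≤m+n (toℕ p) _)) (<⇒≤ (toℕ<n p)))
    ... | inj₁ p<end = inj₂ (i≤p , p<end)
    ... | inj₂ p≡end = inj₁ p≡end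

    pdaStart : ℕ → Maybe (Fin n)
    pdaStart v = first (λ i → pdaEnd i ≟ v)

    pdaValues : List ℕ
    pdaValues = deduplicate _≟_ (map pdaEnd (allFin n))

    pdaStarts : List (Fin n)
    pdaStarts = mapMaybe pdaStart pdaValues

    pdaPhrases : List Phrase
    pdaPhrases = map pdaPhrase pdaStarts

    pdaPhrases-cover : ∀ p → Any (Covers (toℕ p)) pdaPhrases
    pdaPhrases-cover p =
      Any.map⁺ (Any.mapMaybe⁺ pdaStart pdaValues (Any.map⁺ (lose pdaEnd[p]∈ start-covers)))
      where
      pdaEnd[p]∈ : pdaEnd p ∈ pdaValues
      pdaEnd[p]∈ = ∈-deduplicate⁺ _≟_ (∈-map⁺ pdaEnd (∈-allFin p))
      start-covers : MaybeAny.Any (Covers (toℕ p) ∘ pdaPhrase) (pdaStart (pdaEnd p))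
      start-covers = MaybeAny.map (λ (same-end , i≤p) → pdaPhrase-covers i≤p same-end)
                                  (first-least (λ i → pdaEnd i ≟ pdaEnd p) refl)

    pdaPhrases-sound : OrderPreserving S π → All Sound pdaPhrases
    pdaPhrases-sound op = map⁺ (All.universal (pdaPhrase-sound op) pdaStarts)

    pdaPhrase-bounded : σ ≤ n → ∀ i → All (_≤ n) (phraseℕs (pdaPhrase i))
    pdaPhrase-bounded σ≤n i =
      <⇒≤ (toℕ<n i) ∷ m⊓n≤n (pdaEnd i) n ∷ source≤n (LPF-attained i) ∷ char≤n (charAt S (phraseEnd i)) ∷ []
      where
      source≤n : (a : LPF S π i ≡ 0 ⊎ LPFWitness i) → sourceOf a ≤ n
      source≤n (inj₁ _)       = z≤n
      source≤n (inj₂ (j , _)) = <⇒≤ (toℕ<n j)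
      char≤n : ∀ mc → maybe′ toℕ 0 mc ≤ n
      char≤n nothing  = z≤n
      char≤n (just c) = ≤-trans (<⇒≤ (toℕ<n c)) σ≤n

    pdaPhrases-bounded : σ ≤ n → All (All (_≤ n) ∘ phraseℕs) pdaPhrases
    pdaPhrases-bounded σ≤n = map⁺ (All.universal (pdaPhrase-bounded σ≤n) pdaStarts)

    length-pdaPhrases : length pdaPhrases ≤ pdaSize S π
    length-pdaPhrases =
      ≤-trans (≤-reflexive (length-map pdaPhrase pdaStarts)) (length-mapMaybe pdaStart pdaValues)

    decodeParse-pdaPhrases : OrderPreserving S π →
                             decodeParse (encodeParse n pdaPhrases) ≡ map toℕ (toList S)
    decodeParse-pdaPhrases op = begin
      decodeParse (encodeParse n pdaPhrases)          ≡⟨ decodeParse-encodeParse n pdaPhrases ⟩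
      tabulate (λ p → resolve n pdaPhrases (toℕ p))  ≡⟨ tabulate-cong resolved ⟩
      tabulate (λ p → toℕ (lookup S p))               ≡⟨ tabulate-lookup-toList toℕ S ⟩
      map toℕ (toList S)                              ∎
      where
      open ≡-Reasoning
      resolved : ∀ p → resolve n pdaPhrases (toℕ p) ≡ toℕ (lookup S p)
      resolved p = resolve-correct (pdaPhrases-sound op) pdaPhrases-cover n p (toℕ<n _)

theorem16 : Σ ℕ λ c → Σ (List Bool → List ℕ) λ decode →
              ∀ (n σ : ℕ) → σ ≤ n → (S : Vec (Fin σ) n) → (π : Permutation′ n) →
              OrderPreserving S π →
              Σ (List Bool) λ bits →
                (length bits ≤ c * (pdaSize S π * (1 + ⌊log₂ n ⌋))) ×
                (decode bits ≡ map toℕ (toList S))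
theorem16 = 15 , decodeParse , λ where
  zero      _ _   [] _ _  → [] , z≤n , refl
  n@(suc _) _ σ≤n S  π op →
    encodeParse n (pdaPhrases S π) ,
    -- for n > 0, pdaSize S π computes to a successor
    length-encodeParse (pdaPhrases-bounded S π σ≤n) (length-pdaPhrases S π) (s≤s z≤n) ,
    decodeParse-pdaPhrases S π op
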